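{- Let $T$ be a string of length $n$ over $[0\,..\,\sigma)$, let $\tau=\lfloor\frac1{18}\log_\sigma n\rfloor$, and let $\mathbf{Sync}$ be a $\tau$-synchronizing set of $T$. Then: (a) if a run $R$ of $T$ has period $p\ge 2\tau-1$, then $R$ has a unique sparse-Lyndon root; (b) two runs $R_1$ and $R_2$ of $T$ with the same period $p\ge 2\tau$ have the same Lyndon root if and only if they have the same sparse-Lyndon root.
   Context: Strings are 0-indexed; $T[i\,..\,j]$ is a fragment and $T[i\,..\,j)=T[i\,..\,j-1]$. A positive integer $r\le|S|$ is a period of $S$ if $S[i]=S[i+r]$ for all valid $i$; $\mathrm{per}(S)$ is the smallest period; $S$ is periodic if $\mathrm{per}(S)\le|S|/2$. A run of $T$ is a periodic fragment $T[a\,..\,b]$ with $r=\mathrm{per}(T[a\,..\,b])$ such that ($a=0$ or $T[a-1]\ne T[a-1+r]$) and ($b=|T|-1$ or $T[b+1]\ne T[b+1-r]$). The Lyndon root of a periodic string $S$ is the lexicographically smallest rotation of $S[0\,..\,\mathrm{per}(S))$. For a positive integer $\tau\le n/2$, a set $\mathbf{Sync}\subseteq[0\,..\,n-2\tau]$ is a $\tau$-synchronizing set of $T$ if (consistency) whenever $T[i\,..\,i+2\tau)=T[j\,..\,j+2\tau)$, $i\in\mathbf{Sync}$ iff $j\in\mathbf{Sync}$; and (density) for every $i\in[0\,..\,n-3\tau+1]$, $\mathbf{Sync}\cap[i\,..\,i+\tau)=\emptyset$ iff $\mathrm{per}(T[i\,..\,i+3\tau-2])\le\frac13\tau$. For a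 periodic fragment $U=T[a\,..\,b]$ with period $p$, a position $i$ is a sparse-Lyndon position of $U$ if $T[i\,..\,n)$ is the lexicographically minimal string among $\{T[j\,..\,n): j\in[a\,..\,a+p)\cap\mathbf{Sync}\}$; if $U$ has a sparse-Lyndon position $i$, then $T[i\,..\,i+p)$ is called the sparse-Lyndon root of $U$. -}

module Defs where

open import Data.Nat using (ℕ; zero; suc; _+_; _*_; _∸_; _^_; _≤_; _<_)
open import Data.Fin using (Fin)
import Data.Fin as F
open import Data.List using (List; []; _∷_; length; take; drop; _++_)
open import Data.List.Relation.Binary.Lex.Strict using (Lex-≤)
open import Data.Maybe using (Maybe; just; nothing)
open import Data.Product using (Σ; ∃; _×_; _,_)
open import Data.Sum using (_⊎_)
open import Relation.Binary.PropositionalEquality using (_≡_; _≢_)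
open import Relation.Nullary using (¬_)
open import Relation.Unary using (Pred)
open import Level using (0ℓ)

at : {A : Set} → List A → ℕ → Maybe A
at []       _       = nothing
at (x ∷ xs) zero    = just x
at (x ∷ xs) (suc i) = at xs i

frag : {A : Set} → List A → ℕ → ℕ → List A
frag T i k = take k (drop i T)

suffix : {A : Set} → List A → ℕ → List A
suffix T i = drop i T

-- Lexicographic (non-strict) order on strings over [0..σ); a proper prefix is smaller.
_≤lex_ : {σ : ℕ} → List (Fin σ) → List (Fin σ) → Set
_≤lex_ = Lex-≤ _≡_ F._<_

Period : {A : Set} → List A → ℕ → Set
Period S r = 1 ≤ r × r ≤ length S × (∀ i → i + r < length S → at S i ≡ at S (i + r))

IsPer : {A : Set} → List A → ℕ → Set
IsPer S r = Period S r × (∀ q → Period S q → r ≤ q)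

PerAtMostThird : {A : Set} → List A → ℕ → Set
PerAtMostThird S τ = Σ ℕ λ r → IsPer S r × 3 * r ≤ τ

IsSyncSet : {σ : ℕ} → (T : List (Fin σ)) → (τ : ℕ) → Pred ℕ 0ℓ → Set
IsSyncSet T τ Sync =
  (∀ i → Sync i → i + 2 * τ ≤ length T)
  × (∀ i j → i + 2 * τ ≤ length T → j + 2 * τ ≤ length T →
       frag T i (2 * τ) ≡ frag T j (2 * τ) → (Sync i → Sync j) × (Sync j → Sync i))
  × (∀ i → i + 3 * τ ≤ length T + 1 →
       ((∀ k → i ≤ k → k < i + τ → ¬ Sync k) → PerAtMostThird (frag T i (3 * τ ∸ 1)) τ)
       × (PerAtMostThird (frag T i (3 * τ ∸ 1)) τ → (∀ k → i ≤ k → k < i + τ → ¬ Sync k)))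

IsRun : {A : Set} → List A → ℕ → ℕ → ℕ → Set
IsRun T a b p =
  a ≤ b × b < length T
  × IsPer (frag T a (suc b ∸ a)) p
  × 2 * p ≤ suc b ∸ a
  × (a ≡ 0 ⊎ at T (a ∸ 1) ≢ at T (a ∸ 1 + p))
  × (suc b ≡ length T ⊎ at T (suc b) ≢ at T (suc b ∸ p))

IsSparseLyndonPos : {σ : ℕ} → List (Fin σ) → Pred ℕ 0ℓ → ℕ → ℕ → ℕ → Set
IsSparseLyndonPos T Sync a p i =
  (a ≤ i × i < a + p × Sync i)
  × (∀ j → a ≤ j → j < a + p → Sync j → suffix T i ≤lex suffix T j)

IsSparseLyndonRoot : {σ : ℕ} → List (Fin σ) → Pred ℕ 0ℓ → ℕ → ℕ → List (Fin σ) → Set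
IsSparseLyndonRoot T Sync a p L = Σ ℕ λ i → IsSparseLyndonPos T Sync a p i × frag T i p ≡ L

rotation : {A : Set} → List A → ℕ → List A
rotation X k = drop k X ++ take k X

IsLyndonRoot : {σ : ℕ} → List (Fin σ) → ℕ → List (Fin σ) → Set
IsLyndonRoot S p L =
  (Σ ℕ λ k → k < p × rotation (take p S) k ≡ L)
  × (∀ k → k < p → L ≤lex rotation (take p S) k)

module Submission where

-- Part (a).  If the first period [a, a + p) of the run contained no position of Sync,
-- density would give every window T[a + d .. a + d + 3τ - 1), d ≤ p - τ, a period of
-- at most τ/3.  Consecutive windows overlap by more than the sum of their minimal
-- periods, so by Fine and Wilf they all have the same minimal period q < τ, which is
-- then a period of a fragment of the run of length at least p + q.  Fine and Wilf again
-- make gcd(p, q) < p a period of the run, contradicting the minimality of p.  The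
-- sparse-Lyndon position is unique because distinct positions have distinct suffixes.
--
-- Part (b).  The length-p fragments starting in the first period of a run are the
-- rotations of its root, pairwise distinct by primitivity.  If two runs with period p
-- share one of them they share all of them, position by position.  Corresponding
-- positions agree on at least 2τ characters, so they are synchronizing together, and
-- suffixes starting at distinct length-p fragments compare like these fragments.  Hence
-- both the least rotation and the least synchronizing suffix transfer between the runs.

open import Data.Empty using (⊥; ⊥-elim)
open import Data.Fin using (Fin)
import Data.Fin.Properties as Fin
open import Data.List using (List; []; _∷_; length; take; drop; _++_)
open import Data.List.Properties using (length-drop; drop-drop; take-[]; take-take; take++drop≡id; ≡-dec)
open import Data.List.Relation.Binary.Lex.Core using (this; next)
import Data.List.Relation.Binary.Lex.Strict as Lex
open import Data.List.Relation.Binary.Pointwise using (Pointwise-≡⇒≡)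
open import Data.Nat
open import Data.Nat.Divisibility using (_∣_; divides; ∣-antisym; ∣m∣n⇒∣m+n; ∣m+n∣m⇒∣n; ∣⇒≤; 0∣⇒≡0)
open import Data.Nat.GCD using (gcd; gcd[m,n]∣m; gcd[m,n]∣n; gcd-greatest; gcd-comm; gcd-identityʳ)
open import Data.Nat.Induction using (<-wellFounded)
open import Data.Nat.Properties
open import Data.Nat.Tactic.RingSolver using (solve)
open import Data.Product using (Σ; ∃; _×_; _,_; proj₁; proj₂; map₂)
open import Data.Sum using (_⊎_; inj₁; inj₂; [_,_])
open import Data.Unit using (⊤; tt)
open import Function using (_∘_)
open import Induction.WellFounded using (Acc; acc)
open import Level using (0ℓ)
open import Relation.Binary.Definitions using (tri<; tri≈; tri>)
open import Relation.Binary.PropositionalEquality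
  using (_≡_; _≢_; refl; sym; trans; cong; cong₂; subst; subst₂; module ≡-Reasoning)
open import Relation.Binary.Structures using (IsTotalOrder)
open import Relation.Nullary using (¬_; yes; no; contradiction)
open import Relation.Unary using (Pred; Decidable)

open import Defs

+-comm-middle : ∀ a b c → a + b + c ≡ a + c + b
+-comm-middle a b c = solve (a ∷ b ∷ c ∷ [])

∣-positive : ∀ {g r} → 1 ≤ r → g ∣ r → 1 ≤ g
∣-positive 1≤r g∣r = n≢0⇒n>0 λ { refl → <⇒≢ 1≤r (sym (0∣⇒≡0 g∣r)) }

∣⇒≤′ : ∀ {g r} → 1 ≤ r → g ∣ r → g ≤ r
∣⇒≤′ 1≤r = ∣⇒≤ {{>-nonZero 1≤r}}

gcd[m,m+n]≡gcd[m,n] : ∀ m n → gcd m (m + n) ≡ gcd m n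
gcd[m,m+n]≡gcd[m,n] m n = ∣-antisym
  (gcd-greatest (gcd[m,n]∣m m (m + n)) (∣m+n∣m⇒∣n (gcd[m,n]∣n m (m + n)) (gcd[m,n]∣m m (m + n))))
  (gcd-greatest (gcd[m,n]∣m m n) (∣m∣n⇒∣m+n (gcd[m,n]∣m m n) (gcd[m,n]∣n m n)))

module Periodicity {X : Set} (f : ℕ → X) where

  HasPeriod : ℕ → ℕ → ℕ → Set
  HasPeriod lo hi q = ∀ i → lo ≤ i → i + q < hi → f i ≡ f (i + q)

  IsMinPeriod : ℕ → ℕ → ℕ → Set
  IsMinPeriod lo len r =
    1 ≤ r × HasPeriod lo (lo + len) r × (∀ g → 1 ≤ g → g ≤ len → HasPeriod lo (lo + len) g → r ≤ g)

  Agree : ℕ → ℕ → ℕ → Set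
  Agree n x y = ∀ t → t < n → f (x + t) ≡ f (y + t)

  agree-sym : ∀ {n x y} → Agree n x y → Agree n y x
  agree-sym x≈y t t<n = sym (x≈y t t<n)

  agree-trans : ∀ {n x y z} → Agree n x y → Agree n y z → Agree n x z
  agree-trans x≈y y≈z t t<n = trans (x≈y t t<n) (y≈z t t<n)

  agree-restrict : ∀ {n n′ x y} → n′ ≤ n → Agree n x y → Agree n′ x y
  agree-restrict n′≤n x≈y t t<n′ = x≈y t (<-≤-trans t<n′ n′≤n)

  period-restrict : ∀ {lo hi lo′ hi′ q} → lo ≤ lo′ → hi′ ≤ hi → HasPeriod lo hi q → HasPeriod lo′ hi′ q
  period-restrict lo≤lo′ hi′≤hi P i lo′≤i i+q<hi′ = P i (≤-trans lo≤lo′ lo′≤i) (<-≤-trans i+q<hi′ hi′≤hi)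

  period-multiple : ∀ {lo hi g} → HasPeriod lo hi g → ∀ k i → lo ≤ i → i + k * g < hi → f i ≡ f (i + k * g)
  period-multiple P zero i _ _ = cong f (sym (+-identityʳ i))
  period-multiple {hi = hi} {g} P (suc k) i lo≤i i+kg<hi = begin
    f i               ≡⟨ period-multiple P k i lo≤i (≤-<-trans (+-monoʳ-≤ i (m≤n+m (k * g) g)) i+kg<hi) ⟩
    f (i + k * g)     ≡⟨ P (i + k * g) (≤-trans lo≤i (m≤m+n i _)) (subst (_< hi) regroup i+kg<hi) ⟩
    f (i + k * g + g) ≡⟨ cong f (sym regroup) ⟩
    f (i + suc k * g) ∎
    where
      open ≡-Reasoning
      regroup : i + suc k * g ≡ i + k * g + g
      regroup = solve (i ∷ k ∷ g ∷ [])

  period-difference : ∀ {lo hi q d} → HasPeriod lo hi (q + d) → HasPeriod lo hi q →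
                      lo + (q + d + q) ≤ hi → HasPeriod lo hi d
  period-difference {lo} {hi} {q} {d} Pq+d Pq fits i lo≤i i+d<hi with i + (q + d) <? hi
  ... | yes i+q+d<hi = begin
    f i             ≡⟨ Pq+d i lo≤i i+q+d<hi ⟩
    f (i + (q + d)) ≡⟨ cong f reorder ⟩
    f (i + d + q)   ≡⟨ sym (Pq (i + d) (≤-trans lo≤i (m≤m+n i d)) (subst (_< hi) reorder i+q+d<hi)) ⟩
    f (i + d)       ∎
    where
      open ≡-Reasoning
      reorder : i + (q + d) ≡ i + d + q
      reorder = solve (i ∷ q ∷ d ∷ [])
  ... | no i+q+d≮hi = through-lo (m≤n⇒∃[o]m+o≡n lo+q≤i) i+d<hi
    where
      open ≡-Reasoning
      lo+q≤i : lo + q ≤ i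
      lo+q≤i = +-cancelʳ-≤ (q + d) (lo + q) i (subst (_≤ i + (q + d)) regroup (≤-trans fits (≮⇒≥ i+q+d≮hi)))
        where
          regroup : lo + (q + d + q) ≡ lo + q + (q + d)
          regroup = solve (lo ∷ q ∷ d ∷ [])
      through-lo : ∀ {j} → (∃ λ k → lo + q + k ≡ j) → j + d < hi → f j ≡ f (j + d)
      through-lo (k , refl) j+d<hi = begin
        f (lo + q + k)       ≡⟨ cong f (+-comm-middle lo q k) ⟩
        f (lo + k + q)       ≡⟨ sym (Pq (lo + k) (m≤m+n lo k) lo+k+q<hi) ⟩
        f (lo + k)           ≡⟨ Pq+d (lo + k) (m≤m+n lo k) (subst (_< hi) shift j+d<hi) ⟩
        f (lo + k + (q + d)) ≡⟨ cong f (sym shift) ⟩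
        f (lo + q + k + d)   ∎
        where
          shift : lo + q + k + d ≡ lo + k + (q + d)
          shift = solve (lo ∷ q ∷ k ∷ d ∷ [])
          lo+k+q<hi : lo + k + q < hi
          lo+k+q<hi = ≤-<-trans (≤-reflexive (sym (+-comm-middle lo q k))) (≤-<-trans (m≤m+n (lo + q + k) d) j+d<hi)

  private
    period-gcd-acc : ∀ {lo hi p q s} → Acc _<_ s → p + q ≤ s → 1 ≤ p → 1 ≤ q → lo + (p + q) ≤ hi →
                     HasPeriod lo hi p → HasPeriod lo hi q → HasPeriod lo hi (gcd p q)
    period-gcd-≤ : ∀ {lo hi p q s} → Acc _<_ s → p + q ≤ s → p ≤ q → 1 ≤ p → lo + (p + q) ≤ hi →
                   HasPeriod lo hi p → HasPeriod lo hi q → HasPeriod lo hi (gcd p q)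

    period-gcd-acc {lo} {hi} {p} {q} {s} ac p+q≤s 1≤p 1≤q fits Pp Pq with ≤-total p q
    ... | inj₁ p≤q = period-gcd-≤ ac p+q≤s p≤q 1≤p fits Pp Pq
    ... | inj₂ q≤p = subst (HasPeriod lo hi) (gcd-comm q p)
      (period-gcd-≤ ac (subst (_≤ s) (+-comm p q) p+q≤s) q≤p 1≤q (subst (λ x → lo + x ≤ hi) (+-comm p q) fits) Pq Pp)

    period-gcd-≤ {lo} {hi} {p} ac p+q≤s p≤q 1≤p fits Pp Pq with m≤n⇒∃[o]m+o≡n p≤q
    ... | zero , refl = subst (HasPeriod lo hi) (sym (trans (gcd[m,m+n]≡gcd[m,n] p 0) (gcd-identityʳ p))) Pp
    period-gcd-≤ {lo} {hi} {p} (acc rs) p+q≤s p≤q 1≤p fits Pp Pq | suc e , refl =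
      subst (HasPeriod lo hi) (sym (gcd[m,m+n]≡gcd[m,n] p (suc e)))
        (period-gcd-acc (rs (<-≤-trans (m<n+m (p + suc e) 1≤p) p+q≤s)) ≤-refl 1≤p (s≤s z≤n)
           (≤-trans (+-monoʳ-≤ lo (m≤n+m (p + suc e) p)) fits)
           Pp (period-difference Pq Pp (subst (_≤ hi) (cong (lo +_) (+-comm p (p + suc e))) fits)))

  -- The periodicity lemma of Fine and Wilf, in its weak form (length at least p + q).
  period-gcd : ∀ {lo hi p q} → 1 ≤ p → 1 ≤ q → lo + (p + q) ≤ hi →
               HasPeriod lo hi p → HasPeriod lo hi q → HasPeriod lo hi (gcd p q)
  period-gcd {p = p} {q} = period-gcd-acc (<-wellFounded (p + q)) ≤-refl

  period-extendʳ : ∀ {s t hi g k} → 1 ≤ g → HasPeriod s hi (suc k * g) → t < hi →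
                   s + suc k * g ≤ t → HasPeriod s t g → HasPeriod s (suc t) g
  period-extendʳ {s} {t} {hi} {g} {k} 1≤g Pr t<hi s+r≤t Pg i s≤i i+g<1+t with m≤n⇒m<n∨m≡n (s≤s⁻¹ i+g<1+t)
  ... | inj₁ i+g<t = Pg i s≤i i+g<t
  ... | inj₂ i+g≡t = one-period-back (m≤n⇒∃[o]m+o≡n s+kg≤i) i+g≡t
    where
      open ≡-Reasoning
      s+kg≤i : s + k * g ≤ i
      s+kg≤i = +-cancelʳ-≤ g (s + k * g) i (subst₂ _≤_ regroup (sym i+g≡t) s+r≤t)
        where
          regroup : s + suc k * g ≡ s + k * g + g
          regroup = solve (s ∷ k ∷ g ∷ [])
      one-period-back : ∀ {j} → (∃ λ e → s + k * g + e ≡ j) → j + g ≡ t → f j ≡ f (j + g)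
      one-period-back (e , refl) j+g≡t = begin
        f (s + k * g + e)     ≡⟨ cong f (+-comm-middle s (k * g) e) ⟩
        f (s + e + k * g)     ≡⟨ sym (period-multiple Pg k (s + e) (m≤m+n s e) s+e+kg<t) ⟩
        f (s + e)             ≡⟨ Pr (s + e) (m≤m+n s e) (subst (_< hi) (sym s+e+r≡t) t<hi) ⟩
        f (s + e + suc k * g) ≡⟨ cong f regroup ⟩
        f (s + k * g + e + g) ∎
        where
          regroup : s + e + suc k * g ≡ s + k * g + e + g
          regroup = solve (s ∷ e ∷ k ∷ g ∷ [])
          s+e+r≡t : s + e + suc k * g ≡ t
          s+e+r≡t = trans regroup j+g≡t
          s+e+kg<t : s + e + k * g < t
          s+e+kg<t = subst₂ _<_ (+-comm-middle s (k * g) e) j+g≡t (m<m+n (s + k * g + e) 1≤g)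

  period-extendˡ : ∀ {lo hi x g k} → 1 ≤ g → HasPeriod lo hi (suc k * g) → lo ≤ x →
                   x + suc k * g < hi → HasPeriod (suc x) hi g → HasPeriod x hi g
  period-extendˡ {lo} {hi} {x} {g} {k} 1≤g Pr lo≤x x+r<hi Pg i x≤i i+g<hi with m≤n⇒m<n∨m≡n x≤i
  ... | inj₁ x<i = Pg i x<i i+g<hi
  ... | inj₂ refl = begin
    f x               ≡⟨ Pr x lo≤x x+r<hi ⟩
    f (x + suc k * g) ≡⟨ cong f regroup ⟩
    f (x + g + k * g) ≡⟨ sym (period-multiple Pg k (x + g) (m<m+n x 1≤g) (subst (_< hi) regroup x+r<hi)) ⟩
    f (x + g)         ∎
    where
      open ≡-Reasoning
      regroup : x + suc k * g ≡ x + g + k * g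
      regroup = solve (x ∷ g ∷ k ∷ [])

  -- Grow the window one position at a time: the new position is r away from a
  -- position where g is already a period, and r is a multiple of g.
  divisor-period-extend : ∀ {lo hi s r g} → 1 ≤ r → g ∣ r → HasPeriod lo hi r → lo ≤ s → s + r ≤ hi →
                          HasPeriod s (s + r) g → HasPeriod lo hi g
  divisor-period-extend 1≤r (divides zero refl) = contradiction 1≤r λ ()
  divisor-period-extend {lo} {hi} {s} {_} {g} 1≤r g∣r@(divides (suc k) refl) Pr lo≤s s+r≤hi Pg =
    extend-left (s ∸ lo) (≤-reflexive lo+[s∸lo]≡s) (subst (λ x → HasPeriod x hi g) (sym lo+[s∸lo]≡s) up-to-hi)
    where
      r : ℕ
      r = suc k * g
      1≤g : 1 ≤ g
      1≤g = ∣-positive 1≤r g∣r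
      lo+[s∸lo]≡s : lo + (s ∸ lo) ≡ s
      lo+[s∸lo]≡s = m+[n∸m]≡n lo≤s
      extend-right : ∀ n → s + r + n ≤ hi → HasPeriod s (s + r + n) g
      extend-right zero    _    = subst (λ x → HasPeriod s x g) (sym (+-identityʳ (s + r))) Pg
      extend-right (suc n) fits = subst (λ x → HasPeriod s x g) (sym (+-suc (s + r) n))
        (period-extendʳ {k = k} 1≤g (period-restrict lo≤s ≤-refl Pr) (subst (_≤ hi) (+-suc (s + r) n) fits)
          (m≤m+n (s + r) n) (extend-right n (≤-trans (+-monoʳ-≤ (s + r) (n≤1+n n)) fits)))
      up-to-hi : HasPeriod s hi g
      up-to-hi = subst (λ x → HasPeriod s x g) (m+[n∸m]≡n s+r≤hi)
                   (extend-right (hi ∸ (s + r)) (≤-reflexive (m+[n∸m]≡n s+r≤hi)))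
      extend-left : ∀ n → lo + n ≤ s → HasPeriod (lo + n) hi g → HasPeriod lo hi g
      extend-left zero    _      P = subst (λ x → HasPeriod x hi g) (+-identityʳ lo) P
      extend-left (suc n) lo+n<s P = extend-left n (<⇒≤ lo+n<s′)
        (period-extendˡ {k = k} 1≤g Pr (m≤m+n lo n) (<-≤-trans (+-monoˡ-< r lo+n<s′) s+r≤hi)
          (subst (λ x → HasPeriod x hi g) (+-suc lo n) P))
        where
          lo+n<s′ : lo + n < s
          lo+n<s′ = subst (_≤ s) (+-suc lo n) lo+n<s

  minPeriod-≤-divisor : ∀ {lo len r s g} → IsMinPeriod lo len r → g ∣ r → lo ≤ s → s + r ≤ lo + len →
                        HasPeriod s (s + r) g → r ≤ g
  minPeriod-≤-divisor {lo} {len} {r} {s} (1≤r , Pr , least) g∣r lo≤s s+r≤hi Pg =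
    least _ (∣-positive 1≤r g∣r) (≤-trans (∣⇒≤′ 1≤r g∣r) r≤len) (divisor-period-extend 1≤r g∣r Pr lo≤s s+r≤hi Pg)
    where
      r≤len : r ≤ len
      r≤len = +-cancelˡ-≤ lo r len (≤-trans (+-monoˡ-≤ r lo≤s) s+r≤hi)

  minPeriod-overlap : ∀ {i c r r′} → IsMinPeriod i c r → IsMinPeriod (suc i) c r′ → r + r′ < c → r ≡ r′
  minPeriod-overlap {i} {c} {r} {r′} Mr@(1≤r , Pr , _) Mr′@(1≤r′ , Pr′ , _) r+r′<c =
    trans (≤-antisym r≤g g≤r) (≤-antisym g≤r′ r′≤g)
    where
      g : ℕ
      g = gcd r r′
      g≤r : g ≤ r
      g≤r = ∣⇒≤′ 1≤r (gcd[m,n]∣m r r′)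
      g≤r′ : g ≤ r′
      g≤r′ = ∣⇒≤′ 1≤r′ (gcd[m,n]∣n r r′)
      overlap-fits : suc i + (r + r′) ≤ i + c
      overlap-fits = subst (_≤ i + c) (+-suc i (r + r′)) (+-monoʳ-≤ i r+r′<c)
      Pg : HasPeriod (suc i) (i + c) g
      Pg = period-gcd 1≤r 1≤r′ overlap-fits
             (period-restrict (n≤1+n i) ≤-refl Pr) (period-restrict ≤-refl (n≤1+n (i + c)) Pr′)
      window-fits : ∀ x → x ≤ r + r′ → suc i + x ≤ i + c
      window-fits x x≤ = ≤-trans (+-monoʳ-≤ (suc i) x≤) overlap-fits
      r≤g : r ≤ g
      r≤g = minPeriod-≤-divisor Mr (gcd[m,n]∣m r r′) (n≤1+n i) (window-fits r (m≤m+n r r′))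
              (period-restrict ≤-refl (window-fits r (m≤m+n r r′)) Pg)
      r′≤g : r′ ≤ g
      r′≤g = minPeriod-≤-divisor Mr′ (gcd[m,n]∣n r r′) ≤-refl (≤-trans (window-fits r′ (m≤n+m r′ r)) (n≤1+n (i + c)))
               (period-restrict ≤-refl (window-fits r′ (m≤n+m r′ r)) Pg)

  period-of-windows : ∀ {a m c q} → q < c → (∀ d → d ≤ m → HasPeriod (a + d) (a + d + c) q) →
                      HasPeriod a (a + (m + c)) q
  period-of-windows {a} {m} {c} {q} q<c windows i a≤i i+q<end with i ≤? a + m
  ... | yes i≤a+m = in-window (m≤n⇒∃[o]m+o≡n a≤i) i≤a+m
    where
      in-window : ∀ {j} → (∃ λ d → a + d ≡ j) → j ≤ a + m → f j ≡ f (j + q)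
      in-window (d , refl) j≤a+m = windows d (+-cancelˡ-≤ a d m j≤a+m) (a + d) ≤-refl (+-monoʳ-< (a + d) q<c)
  ... | no i≰a+m = windows m ≤-refl i (<⇒≤ (≰⇒> i≰a+m)) (subst (i + q <_) (sym (+-assoc a m c)) i+q<end)

  agree-period : ∀ {x p} → HasPeriod x (x + p + p) p → Agree p (x + p) x
  agree-period {x} {p} P t t<p =
    trans (cong f (+-comm-middle x p t)) (sym (P (x + t) (m≤m+n x t) (+-monoˡ-< p (+-monoʳ-< x t<p))))

  agree⇒period : ∀ {n x d} → Agree n x (x + d) → HasPeriod x (x + d + n) d
  agree⇒period {n} {x} {d} x≈x+d i x≤i i+d<end = shifted (m≤n⇒∃[o]m+o≡n x≤i) i+d<end
    where
      shifted : ∀ {j} → (∃ λ t → x + t ≡ j) → j + d < x + d + n → f j ≡ f (j + d)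
      shifted (t , refl) x+t+d<end = trans (x≈x+d t t<n) (cong f (+-comm-middle x d t))
        where
          t<n : t < n
          t<n = +-cancelˡ-< (x + d) t n (subst (_< x + d + n) (+-comm-middle x t d) x+t+d<end)

  -- Beyond x + p the characters are read back one period earlier, where x and y still agree.
  agree-shift : ∀ {p x y d} → HasPeriod x (x + d + p) p → HasPeriod y (y + d + p) p → d ≤ p →
                Agree p x y → Agree p (x + d) (y + d)
  agree-shift {p} {x} {y} {d} Px Py d≤p x≈y t t<p with d + t <? p
  ... | yes d+t<p = trans (cong f (+-assoc x d t)) (trans (x≈y (d + t) d+t<p) (cong f (sym (+-assoc y d t))))
  ... | no d+t≮p = wrapped (m≤n⇒∃[o]m+o≡n (≮⇒≥ d+t≮p))
    where
      open ≡-Reasoning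
      wrapped : (∃ λ u → p + u ≡ d + t) → f (x + d + t) ≡ f (y + d + t)
      wrapped (u , p+u≡d+t) = begin
        f (x + d + t) ≡⟨ cong f (unfold x) ⟩
        f (x + u + p) ≡⟨ sym (Px (x + u) (m≤m+n x u) (bound x)) ⟩
        f (x + u)     ≡⟨ x≈y u (<-≤-trans u<d d≤p) ⟩
        f (y + u)     ≡⟨ Py (y + u) (m≤m+n y u) (bound y) ⟩
        f (y + u + p) ≡⟨ cong f (sym (unfold y)) ⟩
        f (y + d + t) ∎
        where
          u+p≡d+t : u + p ≡ d + t
          u+p≡d+t = trans (+-comm u p) p+u≡d+t
          unfold : ∀ z → z + d + t ≡ z + u + p
          unfold z = trans (+-assoc z d t) (trans (cong (z +_) (sym u+p≡d+t)) (sym (+-assoc z u p)))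
          u<d : u < d
          u<d = +-cancelʳ-< p u d (subst (_< d + p) (sym u+p≡d+t) (+-monoʳ-< d t<p))
          bound : ∀ z → z + u + p < z + d + p
          bound z = +-monoˡ-< p (+-monoʳ-< z u<d)

module _ {A : Set} where

  at-drop : ∀ (xs : List A) i t → at (drop i xs) t ≡ at xs (i + t)
  at-drop xs       zero    t = refl
  at-drop []       (suc i) t = refl
  at-drop (x ∷ xs) (suc i) t = at-drop xs i t

  at-take : ∀ (xs : List A) k t → t < k → at (take k xs) t ≡ at xs t
  at-take []       (suc k) t       _         = refl
  at-take (x ∷ xs) (suc k) zero    _         = refl
  at-take (x ∷ xs) (suc k) (suc t) (s≤s t<k) = at-take xs k t t<k

  at-frag : ∀ (T : List A) x k t → t < k → at (frag T x k) t ≡ at T (x + t)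
  at-frag T x k t t<k = trans (at-take (drop x T) k t t<k) (at-drop T x t)

  at-extensionality : ∀ (xs ys : List A) → length xs ≡ length ys →
                      (∀ t → t < length xs → at xs t ≡ at ys t) → xs ≡ ys
  at-extensionality []       []       _   _    = refl
  at-extensionality (x ∷ xs) (y ∷ ys) len same with same zero z<s
  ... | refl = cong (x ∷_) (at-extensionality xs ys (suc-injective len) λ t t<n → same (suc t) (s≤s t<n))

  length-take-≤ : ∀ k (xs : List A) → k ≤ length xs → length (take k xs) ≡ k
  length-take-≤ zero    xs       _         = refl
  length-take-≤ (suc k) (x ∷ xs) (s≤s k≤n) = cong suc (length-take-≤ k xs k≤n)

  length-frag : ∀ (T : List A) x k → x + k ≤ length T → length (frag T x k) ≡ k
  length-frag T       zero    k fits       = length-take-≤ k T fits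
  length-frag (y ∷ T) (suc x) k (s≤s fits) = length-frag T x k fits

  take-+ : ∀ u v (xs : List A) → take (u + v) xs ≡ take u xs ++ take v (drop u xs)
  take-+ zero    v xs       = refl
  take-+ (suc u) v []       = sym (take-[] v)
  take-+ (suc u) v (x ∷ xs) = cong (x ∷_) (take-+ u v xs)

  frag-+ : ∀ (T : List A) x u v → frag T x (u + v) ≡ frag T x u ++ frag T (x + u) v
  frag-+ T x u v = trans (take-+ u v (drop x T)) (cong (λ ys → frag T x u ++ take v ys) (drop-drop x u T))

  suffix-split : ∀ (T : List A) x n → suffix T x ≡ frag T x n ++ suffix T (x + n)
  suffix-split T x n = sym (trans (cong (frag T x n ++_) (sym (drop-drop x n T))) (take++drop≡id n (drop x T)))

  take-length-++ : ∀ (xs ys : List A) → take (length xs) (xs ++ ys) ≡ xs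
  take-length-++ []       ys = refl
  take-length-++ (x ∷ xs) ys = cong (x ∷_) (take-length-++ xs ys)

  drop-length-++ : ∀ (xs ys : List A) → drop (length xs) (xs ++ ys) ≡ ys
  drop-length-++ []       ys = refl
  drop-length-++ (x ∷ xs) ys = drop-length-++ xs ys

  rotation-++ : ∀ (xs ys : List A) → rotation (xs ++ ys) (length xs) ≡ ys ++ xs
  rotation-++ xs ys = cong₂ _++_ (drop-length-++ xs ys) (take-length-++ xs ys)

  drop-injective : ∀ (xs : List A) {i j} → i ≤ length xs → j ≤ length xs → drop i xs ≡ drop j xs → i ≡ j
  drop-injective xs {i} {j} i≤n j≤n eq = begin
    i                           ≡⟨ sym (m∸[m∸n]≡n i≤n) ⟩
    length xs ∸ (length xs ∸ i) ≡⟨ cong (length xs ∸_) (trans (sym (length-drop i xs)) (trans (cong length eq)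
                                                                                          (length-drop j xs))) ⟩
    length xs ∸ (length xs ∸ j) ≡⟨ m∸[m∸n]≡n j≤n ⟩
    j                           ∎
    where open ≡-Reasoning

module _ {σ : ℕ} where

  private
    module ≤lex = IsTotalOrder (Lex.≤-isTotalOrder (Fin.<-isStrictTotalOrder {σ}))

  ≤lex-refl : (xs : List (Fin σ)) → xs ≤lex xs
  ≤lex-refl xs = ≤lex.refl

  ≤lex-trans : {xs ys zs : List (Fin σ)} → xs ≤lex ys → ys ≤lex zs → xs ≤lex zs
  ≤lex-trans = ≤lex.trans

  ≤lex-total : (xs ys : List (Fin σ)) → xs ≤lex ys ⊎ ys ≤lex xs
  ≤lex-total = ≤lex.total

  ≤lex-antisym : {xs ys : List (Fin σ)} → xs ≤lex ys → ys ≤lex xs → xs ≡ ys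
  ≤lex-antisym xs≤ys ys≤xs = Pointwise-≡⇒≡ (≤lex.antisym xs≤ys ys≤xs)

  ≤lex-++-distinct-prefix : (xs ys us vs us′ vs′ : List (Fin σ)) → length xs ≡ length ys → xs ≢ ys →
                            (xs ++ us) ≤lex (ys ++ vs) → (xs ++ us′) ≤lex (ys ++ vs′)
  ≤lex-++-distinct-prefix []       []       _  _  _   _   _   xs≢ys _              = contradiction refl xs≢ys
  ≤lex-++-distinct-prefix (x ∷ xs) (y ∷ ys) _  _  _   _   _   _     (this x<y)     = this x<y
  ≤lex-++-distinct-prefix (x ∷ xs) (y ∷ ys) us vs us′ vs′ len xs≢ys (next refl le) =
    next refl (≤lex-++-distinct-prefix xs ys us vs us′ vs′ (suc-injective len) (xs≢ys ∘ cong (x ∷_)) le)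

  IsLeastOn : Pred ℕ 0ℓ → (ℕ → List (Fin σ)) → ℕ → ℕ → ℕ → Set
  IsLeastOn P key a m i = (a ≤ i × i < a + m × P i) × (∀ j → a ≤ j → j < a + m → P j → key i ≤lex key j)

  private
    earlier-or-last : ∀ {a m j} → j < a + suc m → j < a + m ⊎ j ≡ a + m
    earlier-or-last {a} {m} {j} j<end = m≤n⇒m<n∨m≡n (s≤s⁻¹ (subst (j <_) (+-suc a m) j<end))

    last<end : ∀ a m → a + m < a + suc m
    last<end a m = subst (a + m <_) (sym (+-suc a m)) ≤-refl

    least-on-suc : ∀ {P key a m i} → a ≤ i → i < a + suc m → P i →
                   (∀ j → a ≤ j → j < a + m → P j → key i ≤lex key j) → (P (a + m) → key i ≤lex key (a + m)) →
                   IsLeastOn P key a (suc m) i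
    least-on-suc {P} {key} {a} {m} {i} a≤i i<end Pi earlier last =
      (a≤i , i<end , Pi) , λ j a≤j j<end Pj → by-case j a≤j Pj (earlier-or-last j<end)
      where
        by-case : ∀ j → a ≤ j → P j → j < a + m ⊎ j ≡ a + m → key i ≤lex key j
        by-case j a≤j Pj (inj₁ j<a+m) = earlier j a≤j j<a+m Pj
        by-case j a≤j Pj (inj₂ refl)  = last Pj

  least-on : {P : Pred ℕ 0ℓ} → Decidable P → ∀ key a m →
             Σ ℕ (IsLeastOn P key a m) ⊎ (∀ j → a ≤ j → j < a + m → ¬ P j)
  least-on P? key a zero = inj₂ λ j a≤j j<a+0 _ → <-irrefl refl (<-≤-trans (subst (j <_) (+-identityʳ a) j<a+0) a≤j)
  least-on P? key a (suc m) with least-on P? key a m | P? (a + m)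
  ... | inj₂ none | no ¬Pm =
    inj₂ λ j a≤j j<end Pj → [ (λ j<a+m → none j a≤j j<a+m Pj) , (λ { refl → ¬Pm Pj }) ] (earlier-or-last j<end)
  ... | inj₂ none | yes Pm =
    inj₁ (a + m , least-on-suc (m≤m+n a m) (last<end a m) Pm
                    (λ j a≤j j<a+m Pj → contradiction Pj (none j a≤j j<a+m)) λ _ → ≤lex-refl _)
  ... | inj₁ (i , (a≤i , i<a+m , Pi) , least) | no ¬Pm =
    inj₁ (i , least-on-suc a≤i (<-trans i<a+m (last<end a m)) Pi least λ Pm → contradiction Pm ¬Pm)
  ... | inj₁ (i , (a≤i , i<a+m , Pi) , least) | yes Pm with ≤lex-total (key i) (key (a + m))
  ...   | inj₁ i≤last = inj₁ (i , least-on-suc a≤i (<-trans i<a+m (last<end a m)) Pi least λ _ → i≤last)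
  ...   | inj₂ last≤i =
    inj₁ (a + m , least-on-suc (m≤m+n a m) (last<end a m) Pm
                    (λ j a≤j j<a+m Pj → ≤lex-trans last≤i (least j a≤j j<a+m Pj)) λ _ → ≤lex-refl _)

module Runs {σ : ℕ} (T : List (Fin σ)) where

  open Periodicity (at T) public

  period⇒HasPeriod : ∀ {x k r} → x + k ≤ length T → Period (frag T x k) r → HasPeriod x (x + k) r
  period⇒HasPeriod {x} {k} {r} fits (_ , _ , P) i x≤i i+r<end = shifted (m≤n⇒∃[o]m+o≡n x≤i) i+r<end
    where
      open ≡-Reasoning
      shifted : ∀ {j} → (∃ λ t → x + t ≡ j) → j + r < x + k → at T j ≡ at T (j + r)
      shifted (t , refl) x+t+r<end = begin
        at T (x + t)            ≡⟨ sym (at-frag T x k t (≤-<-trans (m≤m+n t r) t+r<k)) ⟩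
        at (frag T x k) t       ≡⟨ P t (subst (t + r <_) (sym (length-frag T x k fits)) t+r<k) ⟩
        at (frag T x k) (t + r) ≡⟨ at-frag T x k (t + r) t+r<k ⟩
        at T (x + (t + r))      ≡⟨ cong (at T) (sym (+-assoc x t r)) ⟩
        at T (x + t + r)        ∎
        where
          t+r<k : t + r < k
          t+r<k = +-cancelˡ-< x (t + r) k (subst (_< x + k) (+-assoc x t r) x+t+r<end)

  HasPeriod⇒period : ∀ {x k r} → x + k ≤ length T → 1 ≤ r → r ≤ k → HasPeriod x (x + k) r → Period (frag T x k) r
  HasPeriod⇒period {x} {k} {r} fits 1≤r r≤k P = 1≤r , subst (r ≤_) (sym len) r≤k , λ t t+r<len →
    let t+r<k = subst (t + r <_) len t+r<len in begin
      at (frag T x k) t       ≡⟨ at-frag T x k t (≤-<-trans (m≤m+n t r) t+r<k) ⟩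
      at T (x + t)            ≡⟨ P (x + t) (m≤m+n x t) (subst (_< x + k) (sym (+-assoc x t r)) (+-monoʳ-< x t+r<k)) ⟩
      at T (x + t + r)        ≡⟨ cong (at T) (+-assoc x t r) ⟩
      at T (x + (t + r))      ≡⟨ sym (at-frag T x k (t + r) t+r<k) ⟩
      at (frag T x k) (t + r) ∎
    where
      open ≡-Reasoning
      len : length (frag T x k) ≡ k
      len = length-frag T x k fits

  IsPer⇒IsMinPeriod : ∀ {x k r} → x + k ≤ length T → IsPer (frag T x k) r → IsMinPeriod x k r
  IsPer⇒IsMinPeriod fits (Pr@(1≤r , _) , least) =
    1≤r , period⇒HasPeriod fits Pr , λ g 1≤g g≤k Pg → least g (HasPeriod⇒period fits 1≤g g≤k Pg)

  frag≡⇒agree : ∀ {n x y} → frag T x n ≡ frag T y n → Agree n x y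
  frag≡⇒agree {n} {x} {y} eq t t<n =
    trans (sym (at-frag T x n t t<n)) (trans (cong (λ s → at s t) eq) (at-frag T y n t t<n))

  agree⇒frag≡ : ∀ {n x y} → x + n ≤ length T → y + n ≤ length T → Agree n x y → frag T x n ≡ frag T y n
  agree⇒frag≡ {n} {x} {y} x-fits y-fits x≈y =
    at-extensionality _ _ (trans (length-frag T x n x-fits) (sym (length-frag T y n y-fits))) λ t t<len →
      let t<n = subst (t <_) (length-frag T x n x-fits) t<len in
      trans (at-frag T x n t t<n) (trans (x≈y t t<n) (sym (at-frag T y n t t<n)))

  suffix-≤lex-by-prefix : ∀ {n x x′ y y′} → x + n ≤ length T → x′ + n ≤ length T → frag T x n ≢ frag T x′ n →
                          frag T x n ≡ frag T y n → frag T x′ n ≡ frag T y′ n →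
                          suffix T x ≤lex suffix T x′ → suffix T y ≤lex suffix T y′
  suffix-≤lex-by-prefix {n} {x} {x′} {y} {y′} x-fits x′-fits distinct x↦y x′↦y′ x≤x′ =
    subst₂ _≤lex_ (sym (suffix-split T y n)) (sym (suffix-split T y′ n))
      (subst₂ (λ u v → (u ++ suffix T (y + n)) ≤lex (v ++ suffix T (y′ + n))) x↦y x′↦y′
        (≤lex-++-distinct-prefix (frag T x n) (frag T x′ n) _ _ _ _
          (trans (length-frag T x n x-fits) (sym (length-frag T x′ n x′-fits))) distinct
          (subst₂ _≤lex_ (suffix-split T x n) (suffix-split T x′ n) x≤x′)))

  rotation-frag : ∀ s k r → s + (k + r) + k ≤ length T → Agree k (s + (k + r)) s →
                  rotation (frag T s (k + r)) k ≡ frag T (s + k) (k + r)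
  rotation-frag s k r fits repeats = begin
    rotation (frag T s (k + r)) k ≡⟨ cong (λ X → rotation X k) (frag-+ T s k r) ⟩
    rotation (A ++ B) k           ≡⟨ cong (rotation (A ++ B)) (sym |A|≡k) ⟩
    rotation (A ++ B) (length A)  ≡⟨ rotation-++ A B ⟩
    B ++ A                        ≡⟨ cong (B ++_) (sym A-repeats) ⟩
    B ++ frag T (s + k + r) k     ≡⟨ sym (frag-+ T (s + k) r k) ⟩
    frag T (s + k) (r + k)        ≡⟨ cong (frag T (s + k)) (+-comm r k) ⟩
    frag T (s + k) (k + r)        ∎
    where
      open ≡-Reasoning
      A B : List (Fin σ)
      A = frag T s k
      B = frag T (s + k) r
      |A|≡k : length A ≡ k
      |A|≡k = length-frag T s k (≤-trans (+-monoʳ-≤ s (m≤m+n k r)) (≤-trans (m≤m+n (s + (k + r)) k) fits))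
      A-repeats : frag T (s + k + r) k ≡ A
      A-repeats = subst (λ z → frag T z k ≡ A) (sym (+-assoc s k r))
        (agree⇒frag≡ fits (≤-trans (+-monoˡ-≤ k (m≤m+n s (k + r))) fits) repeats)

  record Run (p : ℕ) : Set where
    field
      start width : ℕ
      fits        : start + width ≤ length T
      two-periods : p + p ≤ width
      min-period  : IsMinPeriod start width p

  run-of-IsRun : ∀ {a b p} → IsRun T a b p → Run p
  run-of-IsRun {a} {b} {p} (a≤b , b<n , per , 2p≤width , _) = record
    { start       = a
    ; width       = suc b ∸ a
    ; fits        = fits
    ; two-periods = subst (_≤ suc b ∸ a) (cong (p +_) (+-identityʳ p)) 2p≤width
    ; min-period  = IsPer⇒IsMinPeriod fits per
    }
    where
      fits : a + (suc b ∸ a) ≤ length T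
      fits = subst (_≤ length T) (sym (m+[n∸m]≡n (m≤n⇒m≤1+n a≤b))) b<n

  InFirstPeriod : ∀ {p} → Run p → ℕ → Set
  InFirstPeriod {p} R x = Run.start R ≤ x × x < Run.start R + p

  module RunProperties {p : ℕ} (R : Run p) where

    open Run R public

    1≤p : 1 ≤ p
    1≤p = proj₁ min-period

    periodic : HasPeriod start (start + width) p
    periodic = proj₁ (proj₂ min-period)

    two-periods-fit : start + p + p ≤ start + width
    two-periods-fit = subst (_≤ start + width) (sym (+-assoc start p p)) (+-monoʳ-≤ start two-periods)

    window : ∀ {x d} → start ≤ x → x + d ≤ start + p → HasPeriod x (x + d + p) p
    window s≤x x+d≤ = period-restrict s≤x (≤-trans (+-monoˡ-≤ p x+d≤) two-periods-fit) periodic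

    agree-start : Agree p (start + p) start
    agree-start = agree-period (window ≤-refl ≤-refl)

    fragment-fits : ∀ {x} → InFirstPeriod R x → x + p ≤ length T
    fragment-fits (_ , x<) = ≤-trans (<⇒≤ (+-monoˡ-< p x<)) (≤-trans two-periods-fit fits)

    private
      -- Agreement at distance d gives the period d next to p, and gcd(d, p) < p divides p.
      disagree : ∀ {x y} → start ≤ x → x < y → y < start + p → ¬ Agree p x y
      disagree {x} {y} s≤x x<y y< x≈y =
        <⇒≱ g<p (minPeriod-≤-divisor min-period (gcd[m,n]∣n d p) s≤x x+p≤end
                   (period-restrict ≤-refl (+-monoˡ-≤ p (m≤m+n x d)) Pg))
        where
          d : ℕ
          d = y ∸ x
          x+d≡y : x + d ≡ y
          x+d≡y = m+[n∸m]≡n (<⇒≤ x<y)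
          1≤d : 1 ≤ d
          1≤d = +-cancelˡ-≤ x 1 d (subst (x + 1 ≤_) (sym x+d≡y) (subst (_≤ y) (+-comm 1 x) x<y))
          d<p : d < p
          d<p = +-cancelˡ-< start d p (≤-<-trans (+-monoˡ-≤ d s≤x) (subst (_< start + p) (sym x+d≡y) y<))
          Pg : HasPeriod x (x + d + p) (gcd d p)
          Pg = period-gcd 1≤d 1≤p (≤-reflexive (sym (+-assoc x d p)))
                 (agree⇒period (subst (Agree p x) (sym x+d≡y) x≈y))
                 (window s≤x (subst (_≤ start + p) (sym x+d≡y) (<⇒≤ y<)))
          g<p : gcd d p < p
          g<p = ≤-<-trans (∣⇒≤′ 1≤d (gcd[m,n]∣m d p)) d<p
          x+p≤end : x + p ≤ start + width
          x+p≤end = ≤-trans (+-monoˡ-≤ p (<⇒≤ (<-trans x<y y<))) two-periods-fit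

    agree⇒≡ : ∀ {x y} → InFirstPeriod R x → InFirstPeriod R y → Agree p x y → x ≡ y
    agree⇒≡ {x} {y} (s≤x , x<) (s≤y , y<) x≈y with <-cmp x y
    ... | tri≈ _ x≡y _ = x≡y
    ... | tri< x<y _ _ = contradiction x≈y (disagree s≤x x<y y<)
    ... | tri> _ _ y<x = contradiction (agree-sym x≈y) (disagree s≤y y<x x<)

    rotation-root : ∀ {k} → k < p → rotation (take p (frag T start width)) k ≡ frag T (start + k) p
    rotation-root {k} k<p = begin
      rotation (take p (frag T start width)) k ≡⟨ cong (λ X → rotation X k) root≡ ⟩
      rotation (frag T start p) k              ≡⟨ subst (λ n → rotation (frag T start n) k ≡ frag T (start + k) n) k+r≡p
                                                    (rotation-frag start k r rotation-fits repeats) ⟩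
      frag T (start + k) p                     ∎
      where
        open ≡-Reasoning
        r : ℕ
        r = p ∸ k
        k+r≡p : k + r ≡ p
        k+r≡p = m+[n∸m]≡n (<⇒≤ k<p)
        root≡ : take p (frag T start width) ≡ frag T start p
        root≡ = trans (take-take p width (drop start T))
                  (cong (λ n → take n (drop start T)) (m≤n⇒m⊓n≡m (≤-trans (m≤m+n p p) two-periods)))
        rotation-fits : start + (k + r) + k ≤ length T
        rotation-fits = subst (λ n → start + n + k ≤ length T) (sym k+r≡p)
                          (≤-trans (+-monoʳ-≤ (start + p) (<⇒≤ k<p)) (≤-trans two-periods-fit fits))
        repeats : Agree k (start + (k + r)) start
        repeats = subst (λ n → Agree k (start + n) start) (sym k+r≡p) (agree-restrict (<⇒≤ k<p) agree-start)

  first-period-agree⇒frag≡ : ∀ {p x y} (R₁ R₂ : Run p) → InFirstPeriod R₁ x → InFirstPeriod R₂ y →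
                             Agree p x y → frag T x p ≡ frag T y p
  first-period-agree⇒frag≡ R₁ R₂ x∈ y∈ =
    agree⇒frag≡ (RunProperties.fragment-fits R₁ x∈) (RunProperties.fragment-fits R₂ y∈)

  module _ {p : ℕ} (R₁ R₂ : Run p) where

    private
      module R₁ = RunProperties R₁
      module R₂ = RunProperties R₂

    Correspond : Set
    Correspond = ∀ x → InFirstPeriod R₁ x → Σ ℕ λ y → InFirstPeriod R₂ y × Agree p x y

    private
      offset-≤ : ∀ {a x d} → a ≤ x → x + d ≤ a + p → d ≤ p
      offset-≤ {a} {x} {d} a≤x x+d≤ = +-cancelˡ-≤ a d p (≤-trans (+-monoˡ-≤ d a≤x) x+d≤)

      -- If y + d overshoots the first period of R₂, shift first by e to its end, which
      -- agrees with its start, and then by the remaining d - e.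
      agree-advance : ∀ {x y d} → R₁.start ≤ x → x + d ≤ R₁.start + p → InFirstPeriod R₂ y → Agree p x y →
                      Σ ℕ λ y′ → InFirstPeriod R₂ y′ × Agree p (x + d) y′
      agree-advance {x} {y} {d} s≤x x+d≤ (s≤y , y<) x≈y with y + d <? R₂.start + p
      ... | yes y+d< = y + d , (≤-trans s≤y (m≤m+n y d) , y+d<) ,
                       agree-shift (R₁.window s≤x x+d≤) (R₂.window s≤y (<⇒≤ y+d<)) (offset-≤ s≤x x+d≤) x≈y
      ... | no y+d≮ = R₂.start + d′ , (m≤m+n R₂.start d′ , +-monoʳ-< R₂.start d′<p) , x+d≈s+d′
        where
          e d′ : ℕ
          e  = R₂.start + p ∸ y
          d′ = d ∸ e
          y+e≡ : y + e ≡ R₂.start + p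
          y+e≡ = m+[n∸m]≡n (<⇒≤ y<)
          e≤d : e ≤ d
          e≤d = +-cancelˡ-≤ y e d (subst (_≤ y + d) (sym y+e≡) (≮⇒≥ y+d≮))
          e+d′≡d : e + d′ ≡ d
          e+d′≡d = m+[n∸m]≡n e≤d
          x+e+d′≡x+d : x + e + d′ ≡ x + d
          x+e+d′≡x+d = trans (+-assoc x e d′) (cong (x +_) e+d′≡d)
          1≤e : 1 ≤ e
          1≤e = +-cancelˡ-≤ y 1 e (subst₂ _≤_ (+-comm 1 y) (sym y+e≡) y<)
          d′<p : d′ < p
          d′<p = <-≤-trans (m<n+m d′ 1≤e) (subst (_≤ p) (sym e+d′≡d) (offset-≤ s≤x x+d≤))
          x+e≤ : x + e ≤ R₁.start + p
          x+e≤ = ≤-trans (+-monoʳ-≤ x e≤d) x+d≤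
          x+e≈s : Agree p (x + e) R₂.start
          x+e≈s = agree-trans
            (subst (Agree p (x + e)) y+e≡
              (agree-shift (R₁.window s≤x x+e≤) (R₂.window s≤y (≤-reflexive y+e≡)) (offset-≤ s≤x x+e≤) x≈y))
            R₂.agree-start
          x+d≈s+d′ : Agree p (x + d) (R₂.start + d′)
          x+d≈s+d′ = subst (λ z → Agree p z (R₂.start + d′)) x+e+d′≡x+d
            (agree-shift (R₁.window (≤-trans s≤x (m≤m+n x e)) (subst (_≤ R₁.start + p) (sym x+e+d′≡x+d) x+d≤))
                         (R₂.window ≤-refl (+-monoʳ-≤ R₂.start (<⇒≤ d′<p))) (<⇒≤ d′<p) x+e≈s)

      anchor : ∀ {x y} → InFirstPeriod R₁ x → InFirstPeriod R₂ y → Agree p x y →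
               Σ ℕ λ y₀ → InFirstPeriod R₂ y₀ × Agree p R₁.start y₀
      anchor {x} (s≤x , x<) y∈ x≈y =
        map₂ (λ {y₀} → map₂ λ x+e≈y₀ → agree-trans (agree-sym R₁.agree-start) (subst (λ z → Agree p z y₀) x+e≡ x+e≈y₀))
             (agree-advance s≤x (≤-reflexive x+e≡) y∈ x≈y)
        where
          x+e≡ : x + (R₁.start + p ∸ x) ≡ R₁.start + p
          x+e≡ = m+[n∸m]≡n (<⇒≤ x<)

    correspondence : ∀ {x y} → InFirstPeriod R₁ x → InFirstPeriod R₂ y → Agree p x y → Correspond
    correspondence x∈ y∈ x≈y k (s≤k , k<) with anchor x∈ y∈ x≈y
    ... | y₀ , y₀∈ , s≈y₀ =
      map₂ (map₂ (subst (λ z → Agree p z _) s+d≡k))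
           (agree-advance ≤-refl (subst (_≤ R₁.start + p) (sym s+d≡k) (<⇒≤ k<)) y₀∈ s≈y₀)
      where
        s+d≡k : R₁.start + (k ∸ R₁.start) ≡ k
        s+d≡k = m+[n∸m]≡n s≤k

  common-fragment⇒correspond : ∀ {p x y} (R₁ R₂ : Run p) → InFirstPeriod R₁ x → InFirstPeriod R₂ y →
                               frag T x p ≡ frag T y p → Correspond R₁ R₂ × Correspond R₂ R₁
  common-fragment⇒correspond R₁ R₂ x∈ y∈ x↦y =
    correspondence R₁ R₂ x∈ y∈ (frag≡⇒agree x↦y) , correspondence R₂ R₁ y∈ x∈ (frag≡⇒agree (sym x↦y))

  module _ {p : ℕ} (R : Run p) where

    open RunProperties R

    private
      offset<p : ∀ {x} → InFirstPeriod R x → x ∸ start < p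
      offset<p (s≤x , x<) = +-cancelˡ-< start _ p (subst (_< start + p) (sym (m+[n∸m]≡n s≤x)) x<)

    lyndonRoot-intro : ∀ {x L} → InFirstPeriod R x → frag T x p ≡ L → (∀ y → InFirstPeriod R y → L ≤lex frag T y p) →
                       IsLyndonRoot (frag T start width) p L
    lyndonRoot-intro {x} {L} x∈@(s≤x , _) x↦L least =
      (x ∸ start , offset<p x∈ , trans (rotation-root (offset<p x∈)) (trans (cong (λ z → frag T z p) (m+[n∸m]≡n s≤x)) x↦L)) ,
      λ k k<p → subst (L ≤lex_) (sym (rotation-root k<p)) (least (start + k) (m≤m+n start k , +-monoʳ-< start k<p))

    lyndonRoot-position : ∀ {L} → IsLyndonRoot (frag T start width) p L → Σ ℕ λ x → InFirstPeriod R x × frag T x p ≡ L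
    lyndonRoot-position ((k , k<p , rot≡L) , _) =
      start + k , (m≤m+n start k , +-monoʳ-< start k<p) , trans (sym (rotation-root k<p)) rot≡L

    lyndonRoot-least : ∀ {L} → IsLyndonRoot (frag T start width) p L → ∀ y → InFirstPeriod R y → L ≤lex frag T y p
    lyndonRoot-least {L} (_ , least) y y∈@(s≤y , _) =
      subst (λ z → L ≤lex frag T z p) (m+[n∸m]≡n s≤y)
        (subst (L ≤lex_) (rotation-root (offset<p y∈)) (least (y ∸ start) (offset<p y∈)))

    lyndonRoot-exists : Σ (List (Fin σ)) (IsLyndonRoot (frag T start width) p)
    lyndonRoot-exists with least-on {P = λ _ → ⊤} (λ _ → yes tt) (λ x → frag T x p) start p
    ... | inj₁ (x , (s≤x , x< , _) , least) =
      frag T x p , lyndonRoot-intro (s≤x , x<) refl λ y (s≤y , y<) → least y s≤y y< tt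
    ... | inj₂ empty = contradiction tt (empty start ≤-refl (m<m+n start 1≤p))

  lyndonRoot-transfer : ∀ {p L} (R₁ R₂ : Run p) → Correspond R₁ R₂ → Correspond R₂ R₁ →
                        IsLyndonRoot (frag T (Run.start R₁) (Run.width R₁)) p L →
                        IsLyndonRoot (frag T (Run.start R₂) (Run.width R₂)) p L
  lyndonRoot-transfer {p} {L} R₁ R₂ R₁→R₂ R₂→R₁ root₁ with lyndonRoot-position R₁ root₁
  ... | x , x∈ , x↦L with R₁→R₂ x x∈
  ...   | y , y∈ , x≈y =
    lyndonRoot-intro R₂ y∈ (trans (sym (first-period-agree⇒frag≡ R₁ R₂ x∈ y∈ x≈y)) x↦L) λ z z∈ → above z∈ (R₂→R₁ z z∈)
    where
      above : ∀ {z} → InFirstPeriod R₂ z → (Σ ℕ λ w → InFirstPeriod R₁ w × Agree p z w) → L ≤lex frag T z p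
      above z∈ (w , w∈ , z≈w) =
        subst (L ≤lex_) (first-period-agree⇒frag≡ R₁ R₂ w∈ z∈ (agree-sym z≈w)) (lyndonRoot-least R₁ root₁ w w∈)

  common-sparseLyndonRoot⇒common-lyndonRoot : ∀ {Sync : Pred ℕ 0ℓ} {p} (R₁ R₂ : Run p) →
    (Σ (List (Fin σ)) λ S → IsSparseLyndonRoot T Sync (Run.start R₁) p S × IsSparseLyndonRoot T Sync (Run.start R₂) p S) →
    Σ (List (Fin σ)) λ L → IsLyndonRoot (frag T (Run.start R₁) (Run.width R₁)) p L
                         × IsLyndonRoot (frag T (Run.start R₂) (Run.width R₂)) p L
  common-sparseLyndonRoot⇒common-lyndonRoot R₁ R₂ (S , (i , ((s≤i , i< , _) , _) , i↦S) , (j , ((s≤j , j< , _) , _) , j↦S))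
    with common-fragment⇒correspond R₁ R₂ (s≤i , i<) (s≤j , j<) (trans i↦S (sym j↦S)) | lyndonRoot-exists R₁
  ... | R₁→R₂ , R₂→R₁ | L , root₁ = L , root₁ , lyndonRoot-transfer R₁ R₂ R₁→R₂ R₂→R₁ root₁

module SyncSetProperties {σ : ℕ} {T : List (Fin σ)} {τ : ℕ} {Sync : Pred ℕ 0ℓ} (sync : IsSyncSet T τ Sync) where

  open Runs T

  sync-consistent : ∀ {n x y} → 2 * τ ≤ n → x + n ≤ length T → y + n ≤ length T → Agree n x y → Sync x → Sync y
  sync-consistent {n} {x} {y} 2τ≤n x-fits y-fits x≈y =
    proj₁ (proj₁ (proj₂ sync) x y (fit x-fits) (fit y-fits)
             (agree⇒frag≡ (fit x-fits) (fit y-fits) (agree-restrict 2τ≤n x≈y)))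
    where
      fit : ∀ {z} → z + n ≤ length T → z + 2 * τ ≤ length T
      fit {z} z-fits = ≤-trans (+-monoʳ-≤ z 2τ≤n) z-fits

  module SyncFreeFirstPeriod (1≤τ : 1 ≤ τ) {m : ℕ} (R : Run (τ + m)) (2τ≤1+p : 2 * τ ≤ suc (τ + m))
           (sync-free : ∀ k → Run.start R ≤ k → k < Run.start R + (τ + m) → ¬ Sync k) where

    open RunProperties R

    private
      p c : ℕ
      p = τ + m
      c = 3 * τ ∸ 1

      c+1≡3τ : c + 1 ≡ 3 * τ
      c+1≡3τ = m∸n+n≡m (≤-trans 1≤τ (m≤m+n τ _))

      τ+τ≤c : τ + τ ≤ c
      τ+τ≤c = +-cancelʳ-≤ 1 (τ + τ) c (subst (τ + τ + 1 ≤_) (sym c+1≡3τ) (subst (_≤ 3 * τ) (+-comm 1 (τ + τ)) 2τ<3τ))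
        where
          2τ<3τ : τ + τ < τ + (τ + (τ + 0))
          2τ<3τ = +-monoʳ-< τ (m<m+n τ (≤-trans 1≤τ (m≤m+n τ 0)))

      m+3τ≤width+1 : m + 3 * τ ≤ width + 1
      m+3τ≤width+1 = begin
        m + 3 * τ          ≡⟨ regroup ⟩
        p + 2 * τ          ≤⟨ +-monoʳ-≤ p 2τ≤1+p ⟩
        p + suc p          ≡⟨ +-suc p p ⟩
        suc (p + p)        ≤⟨ s≤s two-periods ⟩
        suc width          ≡⟨ +-comm 1 width ⟩
        width + 1          ∎
        where
          open ≤-Reasoning hiding (start)
          regroup : m + 3 * τ ≡ τ + m + 2 * τ
          regroup = solve (m ∷ τ ∷ [])

      window-fits : ∀ d → d ≤ m → start + d + 3 * τ ≤ length T + 1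
      window-fits d d≤m = begin
        start + d + 3 * τ   ≡⟨ +-assoc start d (3 * τ) ⟩
        start + (d + 3 * τ) ≤⟨ +-monoʳ-≤ start (+-monoˡ-≤ (3 * τ) d≤m) ⟩
        start + (m + 3 * τ) ≤⟨ +-monoʳ-≤ start m+3τ≤width+1 ⟩
        start + (width + 1) ≡⟨ sym (+-assoc start width 1) ⟩
        start + width + 1   ≤⟨ +-monoˡ-≤ 1 fits ⟩
        length T + 1        ∎
        where open ≤-Reasoning hiding (start)

      window-period : ∀ d → d ≤ m → Σ ℕ λ r → IsMinPeriod (start + d) c r × 3 * r ≤ τ
      window-period d d≤m = as-min-period (proj₁ (proj₂ (proj₂ sync) (start + d) (window-fits d d≤m)) sync-free-window)
        where
          sync-free-window : ∀ k → start + d ≤ k → k < start + d + τ → ¬ Sync k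
          sync-free-window k s+d≤k k< = sync-free k (≤-trans (m≤m+n start d) s+d≤k)
            (<-≤-trans k< (subst (start + d + τ ≤_) (+-assoc start τ m)
              (subst (_≤ start + τ + m) (+-comm-middle start τ d) (+-monoʳ-≤ (start + τ) d≤m))))
          window-fits′ : start + d + c ≤ length T
          window-fits′ = +-cancelʳ-≤ 1 (start + d + c) (length T)
            (subst (_≤ length T + 1) (trans (cong (start + d +_) (sym c+1≡3τ)) (sym (+-assoc (start + d) c 1)))
              (window-fits d d≤m))
          as-min-period : PerAtMostThird (frag T (start + d) c) τ → Σ ℕ λ r → IsMinPeriod (start + d) c r × 3 * r ≤ τ
          as-min-period (r , per , 3r≤τ) = r , IsPer⇒IsMinPeriod window-fits′ per , 3r≤τ

      small-period : ∀ {r} → 1 ≤ r → 3 * r ≤ τ → r < τ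
      small-period {r} 1≤r 3r≤τ = <-≤-trans (m<m+n r (≤-trans 1≤r (m≤m+n r (r + 0)))) 3r≤τ

      q : ℕ
      q = proj₁ (window-period 0 z≤n)

      3q≤τ : 3 * q ≤ τ
      3q≤τ = proj₂ (proj₂ (window-period 0 z≤n))

      windows-min-period : ∀ d → d ≤ m → IsMinPeriod (start + d) c q
      windows-min-period zero    _   = proj₁ (proj₂ (window-period 0 z≤n))
      windows-min-period (suc d) d<m with window-period (suc d) d<m
      ... | r , Mr , 3r≤τ = subst (IsMinPeriod (start + suc d) c) (sym q≡r) Mr
        where
          Mq : IsMinPeriod (start + d) c q
          Mq = windows-min-period d (<⇒≤ d<m)
          q≡r : q ≡ r
          q≡r = minPeriod-overlap Mq (subst (λ i → IsMinPeriod i c r) (+-suc start d) Mr)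
                  (<-≤-trans (+-mono-<-≤ (small-period (proj₁ Mq) 3q≤τ) (≤-trans (m≤m+n r _) 3r≤τ)) τ+τ≤c)

    impossible : ⊥
    impossible = <⇒≱ gcd<p (minPeriod-≤-divisor min-period (gcd[m,n]∣m p q) ≤-refl (+-monoʳ-≤ start p≤width)
                               (period-restrict ≤-refl (+-monoʳ-≤ start (≤-trans (m≤m+n p q) p+q≤m+c)) Pg))
      where
        1≤q : 1 ≤ q
        1≤q = proj₁ (windows-min-period 0 z≤n)
        q<τ : q < τ
        q<τ = small-period 1≤q 3q≤τ
        m+c≤width : m + c ≤ width
        m+c≤width = +-cancelʳ-≤ 1 (m + c) width
          (subst (_≤ width + 1) (trans (cong (m +_) (sym c+1≡3τ)) (sym (+-assoc m c 1))) m+3τ≤width+1)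
        p+q≤m+c : p + q ≤ m + c
        p+q≤m+c = subst (_≤ m + c) (sym regroup) (+-monoʳ-≤ m (≤-trans (+-monoʳ-≤ τ (<⇒≤ q<τ)) τ+τ≤c))
          where
            regroup : τ + m + q ≡ m + (τ + q)
            regroup = trans (cong (_+ q) (+-comm τ m)) (+-assoc m τ q)
        q-period : HasPeriod start (start + (m + c)) q
        q-period = period-of-windows (<-≤-trans q<τ (≤-trans (m≤m+n τ τ) τ+τ≤c))
                     (λ d d≤m → proj₁ (proj₂ (windows-min-period d d≤m)))
        Pg : HasPeriod start (start + (m + c)) (gcd p q)
        Pg = period-gcd 1≤p 1≤q (+-monoʳ-≤ start p+q≤m+c)
               (period-restrict ≤-refl (+-monoʳ-≤ start m+c≤width) periodic) q-period
        gcd<p : gcd p q < p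
        gcd<p = ≤-<-trans (∣⇒≤′ 1≤q (gcd[m,n]∣n p q)) (<-≤-trans q<τ (m≤m+n τ m))
        p≤width : p ≤ width
        p≤width = ≤-trans (m≤m+n p p) two-periods

  private
    τ≤p : ∀ {p} → 1 ≤ τ → 2 * τ ≤ suc p → τ ≤ p
    τ≤p {p} 1≤τ 2τ≤1+p = s≤s⁻¹ (≤-trans (subst (_≤ τ + τ) (+-comm τ 1) (+-monoʳ-≤ τ 1≤τ))
                                      (subst (_≤ suc p) (cong (τ +_) (+-identityʳ τ)) 2τ≤1+p))

    sync-position-fits : ∀ {i} → Sync i → i ≤ length T
    sync-position-fits {i} Si = ≤-trans (m≤m+n i (2 * τ)) (proj₁ sync i Si)

  sync-in-first-period : 1 ≤ τ → ∀ {p} (R : Run p) → 2 * τ ≤ suc p →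
                         ¬ (∀ k → Run.start R ≤ k → k < Run.start R + p → ¬ Sync k)
  sync-in-first-period 1≤τ {p} R 2τ≤1+p sync-free with m≤n⇒∃[o]m+o≡n (τ≤p 1≤τ 2τ≤1+p)
  ... | m , refl = SyncFreeFirstPeriod.impossible 1≤τ R 2τ≤1+p sync-free

  -- IsSparseLyndonPos T Sync a p is IsLeastOn Sync (suffix T) a p.
  sparseLyndonRoot-exists : 1 ≤ τ → Decidable Sync → ∀ {p} (R : Run p) → 2 * τ ≤ suc p →
                            Σ (List (Fin σ)) (IsSparseLyndonRoot T Sync (Run.start R) p)
  sparseLyndonRoot-exists 1≤τ Sync? {p} R 2τ≤1+p with least-on Sync? (suffix T) (Run.start R) p
  ... | inj₁ (i , i-least) = frag T i p , i , i-least , refl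
  ... | inj₂ sync-free     = ⊥-elim (sync-in-first-period 1≤τ R 2τ≤1+p sync-free)

  sparseLyndonRoot-unique : ∀ {a p L L′} → IsSparseLyndonRoot T Sync a p L → IsSparseLyndonRoot T Sync a p L′ → L′ ≡ L
  sparseLyndonRoot-unique {p = p} (i , ((a≤i , i< , Si) , i-least) , i↦L) (i′ , ((a≤i′ , i′< , Si′) , i′-least) , i′↦L′) =
    trans (sym i′↦L′) (trans (cong (λ z → frag T z p) i′≡i) i↦L)
    where
      i′≡i : i′ ≡ i
      i′≡i = drop-injective T (sync-position-fits Si′) (sync-position-fits Si)
               (≤lex-antisym (i′-least i a≤i i< Si) (i-least i′ a≤i′ i′< Si′))

  sparseLyndonRoot-transfer : ∀ {p L} → 2 * τ ≤ p → (R₁ R₂ : Run p) → Correspond R₁ R₂ → Correspond R₂ R₁ →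
                              IsSparseLyndonRoot T Sync (Run.start R₁) p L → IsSparseLyndonRoot T Sync (Run.start R₂) p L
  sparseLyndonRoot-transfer {p} {L} 2τ≤p R₁ R₂ R₁→R₂ R₂→R₁ (i , ((s≤i , i< , Si) , i-least) , i↦L) with R₁→R₂ i (s≤i , i<)
  ... | j , j∈@(s≤j , j<) , i≈j = j , ((s≤j , j< , Sj) , j-least) , trans (sym (same-fragment i∈ j∈ i≈j)) i↦L
    where
      module R₁ = RunProperties R₁
      module R₂ = RunProperties R₂
      i∈ : InFirstPeriod R₁ i
      i∈ = s≤i , i<
      same-fragment : ∀ {x y} → InFirstPeriod R₁ x → InFirstPeriod R₂ y → Agree p x y → frag T x p ≡ frag T y p
      same-fragment = first-period-agree⇒frag≡ R₁ R₂
      Sj : Sync j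
      Sj = sync-consistent 2τ≤p (R₁.fragment-fits i∈) (R₂.fragment-fits j∈) i≈j Si
      -- Equal fragments at i and i′ force i = i′ by primitivity, hence j = j′; distinct ones
      -- decide the order of the suffixes.
      j-least : ∀ j′ → R₂.start ≤ j′ → j′ < R₂.start + p → Sync j′ → suffix T j ≤lex suffix T j′
      j-least j′ s≤j′ j′< Sj′ with R₂→R₁ j′ (s≤j′ , j′<)
      ... | i′ , i′∈ , j′≈i′ with ≡-dec Fin._≟_ (frag T i p) (frag T i′ p)
      ...   | yes i↦i′ = subst (λ z → suffix T j ≤lex suffix T z) j≡j′ (≤lex-refl (suffix T j))
        where
          j≡j′ : j ≡ j′
          j≡j′ = R₂.agree⇒≡ j∈ (s≤j′ , j′<)
                   (agree-trans (agree-sym i≈j) (agree-trans (frag≡⇒agree i↦i′) (agree-sym j′≈i′)))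
      ...   | no i↛i′ = suffix-≤lex-by-prefix {y = j} {y′ = j′} (R₁.fragment-fits i∈) (R₁.fragment-fits i′∈) i↛i′
                          (same-fragment i∈ j∈ i≈j) (same-fragment i′∈ (s≤j′ , j′<) (agree-sym j′≈i′))
                          (i-least i′ (proj₁ i′∈) (proj₂ i′∈) Si′)
        where
          Si′ : Sync i′
          Si′ = sync-consistent 2τ≤p (R₂.fragment-fits (s≤j′ , j′<)) (R₁.fragment-fits i′∈) j′≈i′ Sj′

  sparseLyndonRoot-∃! : 1 ≤ τ → Decidable Sync → ∀ {p} (R : Run p) → 2 * τ ≤ suc p →
    Σ (List (Fin σ)) λ L → IsSparseLyndonRoot T Sync (Run.start R) p L
                         × (∀ L′ → IsSparseLyndonRoot T Sync (Run.start R) p L′ → L′ ≡ L)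
  sparseLyndonRoot-∃! 1≤τ Sync? R 2τ≤1+p with sparseLyndonRoot-exists 1≤τ Sync? R 2τ≤1+p
  ... | L , root = L , root , λ L′ root′ → sparseLyndonRoot-unique root root′

  common-lyndonRoot⇒common-sparseLyndonRoot : 1 ≤ τ → Decidable Sync → ∀ {p} → 2 * τ ≤ p → (R₁ R₂ : Run p) →
    (Σ (List (Fin σ)) λ L → IsLyndonRoot (frag T (Run.start R₁) (Run.width R₁)) p L
                          × IsLyndonRoot (frag T (Run.start R₂) (Run.width R₂)) p L) →
    Σ (List (Fin σ)) λ S → IsSparseLyndonRoot T Sync (Run.start R₁) p S × IsSparseLyndonRoot T Sync (Run.start R₂) p S
  common-lyndonRoot⇒common-sparseLyndonRoot 1≤τ Sync? {p} 2τ≤p R₁ R₂ (L , root₁ , root₂)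
    with lyndonRoot-position R₁ root₁ | lyndonRoot-position R₂ root₂
  ... | x , x∈ , x↦L | y , y∈ , y↦L
    with common-fragment⇒correspond R₁ R₂ x∈ y∈ (trans x↦L (sym y↦L))
       | sparseLyndonRoot-exists 1≤τ Sync? R₁ (≤-trans 2τ≤p (n≤1+n p))
  ... | R₁→R₂ , R₂→R₁ | S , sparse₁ = S , sparse₁ , sparseLyndonRoot-transfer 2τ≤p R₁ R₂ R₁→R₂ R₂→R₁ sparse₁

lemma33 : (σ n : ℕ) (T : List (Fin σ)) → length T ≡ n → 2 ≤ σ →
  (τ : ℕ) → σ ^ (18 * τ) ≤ n → n < σ ^ (18 * suc τ) → 1 ≤ τ → 2 * τ ≤ n →
  (Sync : Pred ℕ 0ℓ) → Decidable Sync → IsSyncSet T τ Sync →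
  (∀ a b p → IsRun T a b p → 2 * τ ≤ suc p →
     Σ (List (Fin σ)) λ L → IsSparseLyndonRoot T Sync a p L
       × (∀ L′ → IsSparseLyndonRoot T Sync a p L′ → L′ ≡ L))
  × (∀ a₁ b₁ a₂ b₂ p → IsRun T a₁ b₁ p → IsRun T a₂ b₂ p → 2 * τ ≤ p →
     ((Σ (List (Fin σ)) λ L → IsLyndonRoot (frag T a₁ (suc b₁ ∸ a₁)) p L
          × IsLyndonRoot (frag T a₂ (suc b₂ ∸ a₂)) p L)
       → (Σ (List (Fin σ)) λ L → IsSparseLyndonRoot T Sync a₁ p L × IsSparseLyndonRoot T Sync a₂ p L))
     × ((Σ (List (Fin σ)) λ L → IsSparseLyndonRoot T Sync a₁ p L × IsSparseLyndonRoot T Sync a₂ p L)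
       → (Σ (List (Fin σ)) λ L → IsLyndonRoot (frag T a₁ (suc b₁ ∸ a₁)) p L
          × IsLyndonRoot (frag T a₂ (suc b₂ ∸ a₂)) p L)))
lemma33 σ n T _ _ τ _ _ 1≤τ _ Sync Sync? sync =
  (λ a b p run → sparseLyndonRoot-∃! 1≤τ Sync? (run-of-IsRun run)) ,
  λ a₁ b₁ a₂ b₂ p run₁ run₂ 2τ≤p →
    common-lyndonRoot⇒common-sparseLyndonRoot 1≤τ Sync? 2τ≤p (run-of-IsRun run₁) (run-of-IsRun run₂) ,
    common-sparseLyndonRoot⇒common-lyndonRoot (run-of-IsRun run₁) (run-of-IsRun run₂)
  where
    open Runs T
    open SyncSetProperties sync
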